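{- Let $A$ be a $p$-semisimple pseudo-BCI algebra and let $d_1,d_2:A\to A$ be maps each of which is both a type I and a type II implicative derivation on $A$. Then $d_1\circ d_2=d_2\circ d_1$.
   Context: A pseudo-BCI algebra is a structure $(A,\to,\rightsquigarrow,1)$ of type $(2,2,0)$ such that for all $x,y,z\in A$: $(x\to y)\rightsquigarrow[(y\to z)\rightsquigarrow(x\to z)]=1$; $(x\rightsquigarrow y)\to[(y\rightsquigarrow z)\to(x\rightsquigarrow z)]=1$; $1\to x=x$; $1\rightsquigarrow x=x$; and $x\to y=1$, $y\to x=1$ imply $x=y$. Write $x\le y$ iff $x\to y=1$. $A$ is $p$-semisimple if $x\le 1$ implies $x=1$. Put $x\Cup_1 y=(x\to y)\rightsquigarrow y$ and $x\Cup_2 y=(x\rightsquigarrow y)\to y$. A map $d:A\to A$ is a type I implicative derivation if $d(x\to y)=(x\to d(y))\Cup_2(d(x)\to y)$ and $d(x\rightsquigarrow y)=(x\rightsquigarrow d(y))\Cup_1(d(x)\rightsquigarrow y)$ for all $x,y$; it is a type II implicative derivation if $d(x\to y)=(d(x)\to y)\Cup_2(x\to d(y))$ and $d(x\rightsquigarrow y)=(d(x)\rightsquigarrow y)\Cup_1(x\rightsquigarrow d(y))$ for all $x,y$. -}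

module Defs where

open import Level using (Level; suc)
open import Data.Product using (_×_)
open import Relation.Binary.PropositionalEquality using (_≡_)

record PseudoBCI (a : Level) : Set (suc a) where
  infixr 5 _⇒_ _⇝_
  field
    Carrier : Set a
    _⇒_     : Carrier → Carrier → Carrier
    _⇝_     : Carrier → Carrier → Carrier
    𝟏       : Carrier
    ax1 : ∀ x y z → (x ⇒ y) ⇝ ((y ⇒ z) ⇝ (x ⇒ z)) ≡ 𝟏
    ax2 : ∀ x y z → (x ⇝ y) ⇒ ((y ⇝ z) ⇒ (x ⇝ z)) ≡ 𝟏
    ax3 : ∀ x → 𝟏 ⇒ x ≡ x
    ax4 : ∀ x → 𝟏 ⇝ x ≡ x
    ax5 : ∀ x y → x ⇒ y ≡ 𝟏 → y ⇒ x ≡ 𝟏 → x ≡ y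

  _≤_ : Carrier → Carrier → Set a
  x ≤ y = x ⇒ y ≡ 𝟏

  _⋓₁_ : Carrier → Carrier → Carrier
  x ⋓₁ y = (x ⇒ y) ⇝ y

  _⋓₂_ : Carrier → Carrier → Carrier
  x ⋓₂ y = (x ⇝ y) ⇒ y

  IsPSemisimple : Set a
  IsPSemisimple = ∀ x → x ≤ 𝟏 → x ≡ 𝟏

  IsTypeIDerivation : (Carrier → Carrier) → Set a
  IsTypeIDerivation d =
    (∀ x y → d (x ⇒ y) ≡ (x ⇒ d y) ⋓₂ (d x ⇒ y)) ×
    (∀ x y → d (x ⇝ y) ≡ (x ⇝ d y) ⋓₁ (d x ⇝ y))

  IsTypeIIDerivation : (Carrier → Carrier) → Set a
  IsTypeIIDerivation d =
    (∀ x y → d (x ⇒ y) ≡ (d x ⇒ y) ⋓₂ (x ⇒ d y)) ×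
    (∀ x y → d (x ⇝ y) ≡ (d x ⇝ y) ⋓₁ (x ⇝ d y))

-- In a p-semisimple pseudo-BCI algebra x ⋓₁ y = x and x ⋓₂ y = x. Putting x = 1 in the type II
-- rules therefore gives d y = d 1 → y = d 1 ⇝ y: such a derivation is a translation, and two
-- translations commute by the exchange law x → (y ⇝ z) = y ⇝ (x → z) of pseudo-BCI algebras.
module Submission where

open import Defs
open import Level using (Level)
open import Function using (_∘_)
open import Relation.Binary.PropositionalEquality
  using (_≡_; sym; trans; cong; cong₂; module ≡-Reasoning)
open import Data.Product using (_,_)

module PseudoBCIProperties {a : Level} (A : PseudoBCI a) where
  open PseudoBCI A
  open ≡-Reasoning

  ≤-refl : ∀ x → x ≤ x
  ≤-refl x = begin
    x ⇒ x                             ≡⟨ ax3 _ ⟨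
    𝟏 ⇒ (x ⇒ x)                       ≡⟨ cong₂ (λ p q → p ⇒ (q ⇒ q)) (ax4 𝟏) (ax4 x) ⟨
    (𝟏 ⇝ 𝟏) ⇒ ((𝟏 ⇝ x) ⇒ (𝟏 ⇝ x))     ≡⟨ ax2 𝟏 𝟏 x ⟩
    𝟏                                 ∎

  x≤x⋓₂y : ∀ x y → x ≤ (x ⋓₂ y)
  x≤x⋓₂y x y = trans (sym (cong₂ (λ p q → p ⇒ ((x ⇝ y) ⇒ q)) (ax4 x) (ax4 y))) (ax2 𝟏 x y)

  x⇝x⋓₁y≡𝟏 : ∀ x y → x ⇝ (x ⋓₁ y) ≡ 𝟏
  x⇝x⋓₁y≡𝟏 x y = trans (sym (cong₂ (λ p q → p ⇝ ((x ⇒ y) ⇝ q)) (ax3 x) (ax3 y))) (ax1 𝟏 x y)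

  ≤⇒⇝≡𝟏 : ∀ {x y} → x ≤ y → x ⇝ y ≡ 𝟏
  ≤⇒⇝≡𝟏 {x} {y} x≤y = begin
    x ⇝ y                ≡⟨ cong (x ⇝_) (ax4 y) ⟨
    x ⇝ (𝟏 ⇝ y)          ≡⟨ cong (λ p → x ⇝ (p ⇝ y)) x≤y ⟨
    x ⇝ ((x ⇒ y) ⇝ y)    ≡⟨ x⇝x⋓₁y≡𝟏 x y ⟩
    𝟏                    ∎

  ⇝≡𝟏⇒≤ : ∀ {x y} → x ⇝ y ≡ 𝟏 → x ≤ y
  ⇝≡𝟏⇒≤ {x} {y} x⇝y≡𝟏 = begin
    x ⇒ y                ≡⟨ cong (x ⇒_) (ax3 y) ⟨
    x ⇒ (𝟏 ⇒ y)          ≡⟨ cong (λ p → x ⇒ (p ⇒ y)) x⇝y≡𝟏 ⟨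
    x ⇒ ((x ⇝ y) ⇒ y)    ≡⟨ x≤x⋓₂y x y ⟩
    𝟏                    ∎

  ⇒-antitoneˡ : ∀ {x y} z → x ≤ y → (y ⇒ z) ≤ (x ⇒ z)
  ⇒-antitoneˡ {x} {y} z x≤y = ⇝≡𝟏⇒≤ (begin
    (y ⇒ z) ⇝ (x ⇒ z)                 ≡⟨ ax4 _ ⟨
    𝟏 ⇝ ((y ⇒ z) ⇝ (x ⇒ z))           ≡⟨ cong (_⇝ ((y ⇒ z) ⇝ (x ⇒ z))) x≤y ⟨
    (x ⇒ y) ⇝ ((y ⇒ z) ⇝ (x ⇒ z))     ≡⟨ ax1 x y z ⟩
    𝟏                                 ∎)

  ⇝-antitoneˡ : ∀ {x y} z → x ≤ y → (y ⇝ z) ≤ (x ⇝ z)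
  ⇝-antitoneˡ {x} {y} z x≤y = begin
    (y ⇝ z) ⇒ (x ⇝ z)                 ≡⟨ ax3 _ ⟨
    𝟏 ⇒ ((y ⇝ z) ⇒ (x ⇝ z))           ≡⟨ cong (_⇒ ((y ⇝ z) ⇒ (x ⇝ z))) (≤⇒⇝≡𝟏 x≤y) ⟨
    (x ⇝ y) ⇒ ((y ⇝ z) ⇒ (x ⇝ z))     ≡⟨ ax2 x y z ⟩
    𝟏                                 ∎

  ≤-trans : ∀ {x y z} → x ≤ y → y ≤ z → x ≤ z
  ≤-trans {x} {y} {z} x≤y y≤z = begin
    x ⇒ z                 ≡⟨ ax3 _ ⟨
    𝟏 ⇒ (x ⇒ z)           ≡⟨ cong (_⇒ (x ⇒ z)) y≤z ⟨
    (y ⇒ z) ⇒ (x ⇒ z)     ≡⟨ ⇒-antitoneˡ z x≤y ⟩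
    𝟏                     ∎

  ⇒-⇝-exchange : ∀ x y z → x ⇒ (y ⇝ z) ≡ y ⇝ (x ⇒ z)
  ⇒-⇝-exchange x y z = ax5 _ _
    (≤-trans (⇝≡𝟏⇒≤ (ax1 x (y ⇝ z) z)) (⇝-antitoneˡ (x ⇒ z) (x≤x⋓₂y y z)))
    (≤-trans (ax2 y (x ⇒ z) z) (⇒-antitoneˡ (y ⇝ z) (⇝≡𝟏⇒≤ (x⇝x⋓₁y≡𝟏 x z))))

module PSemisimpleProperties {a : Level} (A : PseudoBCI a) (semisimple : PseudoBCI.IsPSemisimple A) where
  open PseudoBCI A
  open PseudoBCIProperties A public

  ≤⇒≡ : ∀ {x y} → x ≤ y → x ≡ y
  ≤⇒≡ {x} {y} x≤y = ax5 x y x≤y (semisimple (y ⇒ x) y⇒x≤𝟏)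
    where
    y⇒x≤𝟏 : (y ⇒ x) ≤ 𝟏
    y⇒x≤𝟏 = trans (cong ((y ⇒ x) ⇒_) (sym (≤-refl x))) (⇒-antitoneˡ x x≤y)

  x⋓₂y≡x : ∀ x y → x ⋓₂ y ≡ x
  x⋓₂y≡x x y = sym (≤⇒≡ (x≤x⋓₂y x y))

  x⋓₁y≡x : ∀ x y → x ⋓₁ y ≡ x
  x⋓₁y≡x x y = sym (≤⇒≡ (⇝≡𝟏⇒≤ (x⇝x⋓₁y≡𝟏 x y)))

  typeII⇒d≡d𝟏⇒ : ∀ {d} → IsTypeIIDerivation d → ∀ y → d y ≡ d 𝟏 ⇒ y
  typeII⇒d≡d𝟏⇒ {d} (d-⇒ , _) y =
    trans (cong d (sym (ax3 y))) (trans (d-⇒ 𝟏 y) (x⋓₂y≡x (d 𝟏 ⇒ y) (𝟏 ⇒ d y)))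

  typeII⇒d≡d𝟏⇝ : ∀ {d} → IsTypeIIDerivation d → ∀ y → d y ≡ d 𝟏 ⇝ y
  typeII⇒d≡d𝟏⇝ {d} (_ , d-⇝) y =
    trans (cong d (sym (ax4 y))) (trans (d-⇝ 𝟏 y) (x⋓₁y≡x (d 𝟏 ⇝ y) (𝟏 ⇝ d y)))

proposition4p9 : {a : Level} (A : PseudoBCI a) → PseudoBCI.IsPSemisimple A
                 → (d₁ d₂ : PseudoBCI.Carrier A → PseudoBCI.Carrier A)
                 → PseudoBCI.IsTypeIDerivation A d₁ → PseudoBCI.IsTypeIIDerivation A d₁
                 → PseudoBCI.IsTypeIDerivation A d₂ → PseudoBCI.IsTypeIIDerivation A d₂
                 → ∀ x → (d₁ ∘ d₂) x ≡ (d₂ ∘ d₁) x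
proposition4p9 A semisimple d₁ d₂ _ d₁-typeII _ d₂-typeII x = begin
  d₁ (d₂ x)            ≡⟨ typeII⇒d≡d𝟏⇝ d₁-typeII (d₂ x) ⟩
  d₁ 𝟏 ⇝ d₂ x          ≡⟨ cong (d₁ 𝟏 ⇝_) (typeII⇒d≡d𝟏⇒ d₂-typeII x) ⟩
  d₁ 𝟏 ⇝ (d₂ 𝟏 ⇒ x)    ≡⟨ ⇒-⇝-exchange (d₂ 𝟏) (d₁ 𝟏) x ⟨
  d₂ 𝟏 ⇒ (d₁ 𝟏 ⇝ x)    ≡⟨ cong (d₂ 𝟏 ⇒_) (typeII⇒d≡d𝟏⇝ d₁-typeII x) ⟨
  d₂ 𝟏 ⇒ d₁ x          ≡⟨ typeII⇒d≡d𝟏⇒ d₂-typeII (d₁ x) ⟨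
  d₂ (d₁ x)            ∎
  where
  open PseudoBCI A
  open PSemisimpleProperties A semisimple
  open ≡-Reasoning
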